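{- If a deterministic learning-augmented algorithm for online packet scheduling with deadlines is $1$-consistent, then its competitive ratio (over all real instances and all predictions) cannot be better than $2$.
   Context: Problem: an instance is a collection $\mathcal{J}$ of unit-length jobs $j=(r_j,d_j,w_j)$ (integer release time, integer deadline, nonnegative weight), revealed online at their release times; at each integer time $t$ at most one job is processed and job $j$ may be processed at $t$ only if $r_j\le t\le d_j-1$; the goal is to maximize total processed weight. A learning-augmented algorithm additionally receives at time $0$ a predicted instance $\hat{\mathcal{J}}$. Its competitive ratio on $(\mathcal{J},\hat{\mathcal{J}})$ is $W(\textsc{Opt}(\mathcal{J}))/W(\text{its output})$, where $\textsc{Opt}(\mathcal{J})$ is an optimal offline schedule and $W$ denotes total weight. The algorithm is $\alpha$-consistent if its competitive ratio is at most $\alpha$ on every input whose prediction is exactly correct ($\hat{\mathcal{J}}=\mathcal{J}$). -}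

module Defs where

open import Data.Nat as ℕ using (ℕ; _⊔_)
import Data.Nat.Properties as ℕP
open import Data.Rational as ℚ using (ℚ; 0ℚ)
import Data.Rational.Properties as ℚP
open import Data.List using (List; []; _∷_; map; foldr; filter; upTo; length)
open import Data.List.Relation.Unary.All using (All)
open import Data.Maybe using (Maybe; just; nothing)
open import Data.Product using (_×_)
open import Relation.Nullary using (yes; no; Dec)
open import Relation.Binary.PropositionalEquality using (_≡_; refl; cong)
open import Relation.Binary.Definitions using (DecidableEquality)
import Data.Maybe.Properties as MaybeP

-- A unit-length job: integer release time r, integer deadline d, weight w.
-- It may be processed at integer time t iff r ≤ t ≤ d - 1, i.e. r ≤ t < d.
record Job : Set where
  constructor job
  field
    r : ℕ
    d : ℕ
    w : ℚ
open Job public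

_≟J_ : DecidableEquality Job
job r₁ d₁ w₁ ≟J job r₂ d₂ w₂ with r₁ ℕP.≟ r₂ | d₁ ℕP.≟ d₂ | w₁ ℚP.≟ w₂
... | yes refl | yes refl | yes refl = yes refl
... | no ne | _ | _ = no λ { refl → ne refl }
... | yes _ | no ne | _ = no λ { refl → ne refl }
... | yes _ | yes _ | no ne = no λ { refl → ne refl }

-- An instance is a finite collection (multiset, represented as a list) of jobs.
Instance : Set
Instance = List Job

ValidInstance : Instance → Set
ValidInstance J = All (λ j → 0ℚ ℚ.≤ w j) J

count : Job → Instance → ℕ
count j J = length (filter (λ k → k ≟J j) J)

horizon : Instance → ℕ
horizon J = foldr (λ j m → d j ⊔ m) 0 J

Schedule : Set
Schedule = ℕ → Maybe Job

-- Feasibility of a schedule for an instance: every processed job is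
-- processed inside its window, and each job of the instance is processed
-- at most as often as it occurs in the instance (jobs outside J never),
-- counted over every finite time prefix [0, T).
Feasible : Instance → Schedule → Set
Feasible J S =
  (∀ t j → S t ≡ just j → (r j ℕ.≤ t) × (t ℕ.< d j))
  × (∀ j T → length (filter (λ t → MaybeP.≡-dec _≟J_ (S t) (just j)) (upTo T))
             ℕ.≤ count j J)

weightAt : Maybe Job → ℚ
weightAt (just j) = w j
weightAt nothing  = 0ℚ

-- Total weight of a schedule for J (feasibility forces idleness after horizon J).
W : Instance → Schedule → ℚ
W J S = foldr (λ t acc → weightAt (S t) ℚ.+ acc) 0ℚ (upTo (horizon J))

revealed : ℕ → Instance → Instance
revealed t J = filter (λ j → r j ℕP.≤? t) J

-- A deterministic online learning-augmented algorithm: at each time t it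
-- decides what to process based only on the prediction (given at time 0),
-- the current time, and the jobs revealed so far.
OnlineAlgorithm : Set
OnlineAlgorithm = (Ĵ : Instance) → (t : ℕ) → (revealedJobs : Instance) → Maybe Job

run : OnlineAlgorithm → Instance → Instance → Schedule
run A Ĵ J t = A Ĵ t (revealed t J)

AlwaysFeasible : OnlineAlgorithm → Set
AlwaysFeasible A = ∀ (J Ĵ : Instance) → ValidInstance J → ValidInstance Ĵ →
  Feasible J (run A Ĵ J)

-- 1-consistency: with a correct prediction, the output weight equals the
-- optimum, i.e. no feasible schedule of J has larger weight.
OneConsistent : OnlineAlgorithm → Set
OneConsistent A = ∀ (J : Instance) → ValidInstance J →
  ∀ (S : Schedule) → Feasible J S → W J S ℚ.≤ W J (run A J J)

-- Take β = 3 - c > 1 and the jobs urgent = (0,1,1), long = (0,2,β), late = (1,2,β).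
-- On the prediction Ĵ = {urgent, long, late} the optimum is 2β, while any schedule
-- not starting with long earns at most 1 + β, so a 1-consistent algorithm must start
-- with long. On the real instance J = {urgent, long}, with the same prediction, it has
-- seen the same jobs at time 0, hence again starts with long and then idles: it earns β
-- while the optimum earns 1 + β, and (1 + β)/β > c.
module Submission where

open import Defs
open import Data.Rational using (ℚ; _<_; _*_; 1ℚ; _+_; _≤_; 0ℚ; _-_; -_; Positive; positive)
open import Data.Product using (Σ; _×_; _,_; proj₁; proj₂)
import Data.Rational.Properties as ℚP
open import Data.Rational.Solver using (module +-*-Solver)
open import Data.Nat as ℕ using (ℕ; zero; suc; z≤n; s≤s)
import Data.Nat.Properties as ℕP
open import Data.List using ([]; _∷_; [_]; filter; length; upTo; _++_)
import Data.List.Properties as LP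
open import Data.List.Relation.Unary.All as All using (All; []; _∷_)
open import Data.List.Relation.Unary.Any as Any using (here; there)
open import Data.List.Membership.Propositional using (_∈_; lose)
open import Data.List.Membership.Propositional.Properties using (∈-upTo⁺; ∈-upTo⁻)
open import Data.Maybe using (just; nothing)
import Data.Maybe.Properties as MaybeP
open import Data.Sum using (_⊎_; inj₁; inj₂)
open import Data.Empty using (⊥-elim)
open import Function using (_∘_)
open import Relation.Nullary using (yes; no)
open import Relation.Binary.PropositionalEquality
  using (_≡_; _≢_; refl; sym; cong; cong₂; subst; subst₂; module ≡-Reasoning)

count-pos⇒∈ : ∀ {j} K → 0 ℕ.< count j K → j ∈ K
count-pos⇒∈ {j} (k ∷ K) pos with k ≟J j
... | yes k≡j = here (sym k≡j)
... | no _    = there (count-pos⇒∈ K pos)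

∈⇒count-pos : ∀ {j K} → j ∈ K → 0 ℕ.< count j K
∈⇒count-pos {j} j∈K = LP.filter-some (λ k → k ≟J j) (Any.map sym j∈K)

count-∷-≢ : ∀ {j k} K → k ≢ j → count j (k ∷ K) ≡ count j K
count-∷-≢ {j} K k≢j = cong length (LP.filter-reject (λ k → k ≟J j) k≢j)

module _ (S : Schedule) (j : Job) where

  private
    P? = λ t → MaybeP.≡-dec _≟J_ (S t) (just j)

  occurrences : ℕ → ℕ
  occurrences T = length (filter P? (upTo T))

  occurrences-suc : ∀ T → occurrences (suc T) ≡ occurrences T ℕ.+ length (filter P? [ T ])
  occurrences-suc T = begin
    length (filter P? (upTo (suc T)))              ≡⟨ cong (length ∘ filter P?) (sym (LP.upTo-∷ʳ T)) ⟩
    length (filter P? (upTo T ++ [ T ]))           ≡⟨ cong length (LP.filter-++ P? (upTo T) [ T ]) ⟩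
    length (filter P? (upTo T) ++ filter P? [ T ]) ≡⟨ LP.length-++ (filter P? (upTo T)) ⟩
    occurrences T ℕ.+ length (filter P? [ T ])     ∎
    where open ≡-Reasoning

  occurrences-suc-hit : ∀ T → S T ≡ just j → occurrences (suc T) ≡ suc (occurrences T)
  occurrences-suc-hit T hit = begin
    occurrences (suc T)                        ≡⟨ occurrences-suc T ⟩
    occurrences T ℕ.+ length (filter P? [ T ]) ≡⟨ cong ((occurrences T ℕ.+_) ∘ length) (LP.filter-accept P? hit) ⟩
    occurrences T ℕ.+ 1                        ≡⟨ ℕP.+-comm (occurrences T) 1 ⟩
    suc (occurrences T)                        ∎
    where open ≡-Reasoning

  occurrences-suc-miss : ∀ T → S T ≢ just j → occurrences (suc T) ≡ occurrences T
  occurrences-suc-miss T miss = begin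
    occurrences (suc T)                        ≡⟨ occurrences-suc T ⟩
    occurrences T ℕ.+ length (filter P? [ T ]) ≡⟨ cong ((occurrences T ℕ.+_) ∘ length) (LP.filter-reject P? miss) ⟩
    occurrences T ℕ.+ 0                        ≡⟨ ℕP.+-identityʳ (occurrences T) ⟩
    occurrences T                              ∎
    where open ≡-Reasoning

  occurrences-pos : ∀ {t T} → t ℕ.< T → S t ≡ just j → 0 ℕ.< occurrences T
  occurrences-pos t<T hit = LP.filter-some P? (lose (∈-upTo⁺ t<T) hit)

  occurrences-none : ∀ T → (∀ t → t ℕ.< T → S t ≢ just j) → occurrences T ≡ 0
  occurrences-none T miss =
    cong length (LP.filter-none P? (All.tabulate (λ t∈ → miss _ (∈-upTo⁻ t∈))))

  occurrences-once : ∀ {n} → (∀ s t → S s ≡ just j → S t ≡ just j → s ≡ t) →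
    (∀ t → S t ≡ just j → 0 ℕ.< n) → ∀ T → occurrences T ℕ.≤ n
  occurrences-once once pos zero = z≤n
  occurrences-once {n} once pos (suc T) with P? T
  ... | no miss = subst (ℕ._≤ n) (sym (occurrences-suc-miss T miss)) (occurrences-once once pos T)
  ... | yes hit = begin
    occurrences (suc T) ≡⟨ occurrences-suc-hit T hit ⟩
    suc (occurrences T) ≡⟨ cong suc (occurrences-none T (λ t t<T e → ℕP.<-irrefl (once t T e hit) t<T)) ⟩
    1                   ≤⟨ pos T hit ⟩
    n                   ∎
    where open ℕP.≤-Reasoning

processed⇒∈ : ∀ K {S t j} → Feasible K S → S t ≡ just j → j ∈ K
processed⇒∈ K {S} {t} {j} (_ , bounded) hit =
  count-pos⇒∈ K (ℕP.≤-trans (occurrences-pos S j (ℕP.n<1+n t) hit) (bounded j (suc t)))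

processed-twice : ∀ K {S s t j} → Feasible K S → s ℕ.< t → S s ≡ just j → S t ≡ just j →
  2 ℕ.≤ count j K
processed-twice K {S} {s} {t} {j} (_ , bounded) s<t hit-s hit-t = begin
  2                          ≤⟨ s≤s (occurrences-pos S j s<t hit-s) ⟩
  suc (occurrences S j t)    ≡⟨ sym (occurrences-suc-hit S j t hit-t) ⟩
  occurrences S j (suc t)    ≤⟨ bounded j (suc t) ⟩
  count j K                  ∎
  where open ℕP.≤-Reasoning

weightAt-≤ : ∀ {K S b} → Feasible K S → 0ℚ ≤ b → All (λ j → w j ≤ b) K → ∀ t → weightAt (S t) ≤ b
weightAt-≤ {K} {S} F 0≤b bounds t with S t in hit
... | nothing = 0≤b
... | just j  = All.lookup bounds (processed⇒∈ K F hit)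

once-feasible : ∀ {K S} →
  (∀ t j → S t ≡ just j → (r j ℕ.≤ t) × (t ℕ.< d j)) →
  (∀ t j → S t ≡ just j → j ∈ K) →
  (∀ j s t → S s ≡ just j → S t ≡ just j → s ≡ t) →
  Feasible K S
once-feasible {S = S} window member once =
  window , λ j → occurrences-once S j (once j) (λ t hit → ∈⇒count-pos (member t j hit))

schedule₂ : Job → Job → Schedule
schedule₂ u v zero          = just u
schedule₂ u v (suc zero)    = just v
schedule₂ u v (suc (suc _)) = nothing

schedule₂-feasible : ∀ K {u v} → u ≢ v → u ∈ K → v ∈ K →
  r u ℕ.≤ 0 → 0 ℕ.< d u → r v ℕ.≤ 1 → 1 ℕ.< d v → Feasible K (schedule₂ u v)
schedule₂-feasible K {u} {v} u≢v u∈K v∈K ru du rv dv = once-feasible window member once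
  where
  window : ∀ t j → schedule₂ u v t ≡ just j → (r j ℕ.≤ t) × (t ℕ.< d j)
  window zero       _ refl = ru , du
  window (suc zero) _ refl = rv , dv

  member : ∀ t j → schedule₂ u v t ≡ just j → j ∈ K
  member zero       _ refl = u∈K
  member (suc zero) _ refl = v∈K

  once : ∀ j s t → schedule₂ u v s ≡ just j → schedule₂ u v t ≡ just j → s ≡ t
  once _ zero       zero       _    _ = refl
  once _ (suc zero) (suc zero) _    _ = refl
  once _ zero       (suc zero) refl e = ⊥-elim (u≢v (sym (MaybeP.just-injective e)))
  once _ (suc zero) zero       refl e = ⊥-elim (u≢v (MaybeP.just-injective e))

module Adversary (c : ℚ) (c<2 : c < 1ℚ + 1ℚ) where

  δ : ℚ
  δ = (1ℚ + 1ℚ) - c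

  β : ℚ
  β = 1ℚ + δ

  0<δ : 0ℚ < δ
  0<δ = subst (_< δ) (ℚP.+-inverseʳ c) (ℚP.+-monoˡ-< (- c) c<2)

  1<β : 1ℚ < β
  1<β = subst (_< β) (ℚP.+-identityʳ 1ℚ) (ℚP.+-monoʳ-< 1ℚ 0<δ)

  0≤1 : 0ℚ ≤ 1ℚ
  0≤1 = ℚP.nonNegative⁻¹ 1ℚ

  0≤β : 0ℚ ≤ β
  0≤β = ℚP.≤-trans 0≤1 (ℚP.<⇒≤ 1<β)

  -- (1 + β) - c β = (2 - c)²
  c*β<1+β : c * β < 1ℚ + β
  c*β<1+β = subst₂ _<_ (ℚP.+-identityʳ (c * β)) square (ℚP.+-monoʳ-< (c * β) 0<δ²)
    where
    instance
      _ : Positive δ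
      _ = positive 0<δ
    0<δ² : 0ℚ < δ * δ
    0<δ² = ℚP.positive⁻¹ (δ * δ) {{ℚP.pos*pos⇒pos δ δ}}
    open +-*-Solver
    square : c * β + δ * δ ≡ 1ℚ + β
    square = solve 1 (λ x → x :* (con 1ℚ :+ ((con 1ℚ :+ con 1ℚ) :- x))
                              :+ ((con 1ℚ :+ con 1ℚ) :- x) :* ((con 1ℚ :+ con 1ℚ) :- x)
                          := con 1ℚ :+ (con 1ℚ :+ ((con 1ℚ :+ con 1ℚ) :- x))) refl c

  urgent long late : Job
  urgent = job 0 1 1ℚ
  long   = job 0 2 β
  late   = job 1 2 β

  J Ĵ : Instance
  J = urgent ∷ long ∷ []
  Ĵ = urgent ∷ long ∷ late ∷ []

  valid-J : ValidInstance J
  valid-J = 0≤1 ∷ 0≤β ∷ []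

  valid-Ĵ : ValidInstance Ĵ
  valid-Ĵ = 0≤1 ∷ 0≤β ∷ 0≤β ∷ []

  weights-≤β : All (λ j → w j ≤ β) Ĵ
  weights-≤β = ℚP.<⇒≤ 1<β ∷ ℚP.≤-refl ∷ ℚP.≤-refl ∷ []

  feasible-J : Feasible J (schedule₂ urgent long)
  feasible-J = schedule₂-feasible J (λ ()) (here refl) (there (here refl))
    z≤n (s≤s z≤n) z≤n (s≤s (s≤s z≤n))

  feasible-Ĵ : Feasible Ĵ (schedule₂ long late)
  feasible-Ĵ = schedule₂-feasible Ĵ (λ ()) (there (here refl)) (there (there (here refl)))
    z≤n (s≤s z≤n) (s≤s z≤n) (s≤s (s≤s z≤n))

  count-long-J : count long J ℕ.≤ 1
  count-long-J = subst (ℕ._≤ 1) (sym (count-∷-≢ {long} {urgent} (long ∷ []) (λ ())))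
                   (LP.length-filter (λ k → k ≟J long) (long ∷ []))

  module _ (A : OnlineAlgorithm) (feasible : AlwaysFeasible A) (consistent : OneConsistent A) where

    feasible-Ĵ-Ĵ : Feasible Ĵ (run A Ĵ Ĵ)
    feasible-Ĵ-Ĵ = feasible Ĵ Ĵ valid-Ĵ valid-Ĵ

    feasible-J-Ĵ : Feasible J (run A Ĵ J)
    feasible-J-Ĵ = feasible J Ĵ valid-J valid-Ĵ

    first-choice : run A Ĵ Ĵ 0 ≡ just long ⊎ weightAt (run A Ĵ Ĵ 0) ≤ 1ℚ
    first-choice with run A Ĵ Ĵ 0 in hit
    ... | nothing = inj₂ 0≤1
    ... | just j with processed⇒∈ Ĵ feasible-Ĵ-Ĵ hit
    ...   | here refl                 = inj₂ ℚP.≤-refl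
    ...   | there (here refl)         = inj₁ refl
    ...   | there (there (here refl)) =
      ⊥-elim (ℕP.<-irrefl refl (proj₁ (proj₁ feasible-Ĵ-Ĵ 0 late hit)))

    starts-with-long : run A Ĵ Ĵ 0 ≡ just long
    starts-with-long with first-choice
    ... | inj₁ long-first = long-first
    ... | inj₂ ≤1 = ⊥-elim (ℚP.<-irrefl refl (begin-strict
      β + (β + 0ℚ)              ≤⟨ consistent Ĵ valid-Ĵ (schedule₂ long late) feasible-Ĵ ⟩
      W Ĵ (run A Ĵ Ĵ)           ≤⟨ ℚP.+-mono-≤ ≤1 (ℚP.+-monoˡ-≤ 0ℚ (weightAt-≤ feasible-Ĵ-Ĵ 0≤β weights-≤β 1)) ⟩
      1ℚ + (β + 0ℚ)             <⟨ ℚP.+-monoˡ-< (β + 0ℚ) 1<β ⟩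
      β + (β + 0ℚ)              ∎))
      where open ℚP.≤-Reasoning

    idles-at-1 : run A Ĵ J 1 ≡ nothing
    idles-at-1 with run A Ĵ J 1 in hit
    ... | nothing = refl
    ... | just j with processed⇒∈ J feasible-J-Ĵ hit
    ...   | here refl         =
      ⊥-elim (ℕP.<-irrefl refl (proj₂ (proj₁ feasible-J-Ĵ 1 urgent hit)))
    ...   | there (here refl) = ⊥-elim (ℕP.<-irrefl refl (ℕP.≤-trans long-twice count-long-J))
      where
      -- run A Ĵ J 0 and run A Ĵ Ĵ 0 coincide definitionally: revealed 0 J ≡ revealed 0 Ĵ.
      long-twice : 2 ℕ.≤ count long J
      long-twice = processed-twice J feasible-J-Ĵ (s≤s z≤n) starts-with-long hit

    W-run : W J (run A Ĵ J) ≡ β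
    W-run = begin
      weightAt (run A Ĵ J 0) + (weightAt (run A Ĵ J 1) + 0ℚ)
        ≡⟨ cong₂ (λ x y → weightAt x + (weightAt y + 0ℚ)) starts-with-long idles-at-1 ⟩
      β + 0ℚ
        ≡⟨ ℚP.+-identityʳ β ⟩
      β ∎
      where open ≡-Reasoning

    W-opt : W J (schedule₂ urgent long) ≡ 1ℚ + β
    W-opt = cong (1ℚ +_) (ℚP.+-identityʳ β)

    ratio : c * W J (run A Ĵ J) < W J (schedule₂ urgent long)
    ratio = subst₂ _<_ (cong (c *_) (sym W-run)) (sym W-opt) c*β<1+β

proposition1 : (A : OnlineAlgorithm) → AlwaysFeasible A → OneConsistent A →
    (c : ℚ) → c < 1ℚ + 1ℚ →
    Σ Instance λ J → Σ Instance λ Ĵ → ValidInstance J × ValidInstance Ĵ ×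
      Σ Schedule λ S → Feasible J S × (c * W J (run A Ĵ J) < W J S)
proposition1 A feasible consistent c c<2 =
  J , Ĵ , valid-J , valid-Ĵ , schedule₂ urgent long , feasible-J , ratio A feasible consistent
  where open Adversary c c<2
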